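{- Let $A$ be a finite alphabet of colors and let $J$ be a sentence over $A$. Then the colored dual immaculate function expands in the colored monomial basis as $$\mathfrak{S}^*_J=\sum_{B} K_{J,B}\,M_B,$$ where the sum runs over all sentences $B$ over $A$ with $|B|=|J|$, and $K_{J,B}$ is the number of colored immaculate tableaux of shape $J$ and type $B$ (in particular all coefficients are nonnegative).
   Context: Words over $A$ are finite sequences of colors; a sentence is a finite sequence $I=(w_1,\dots,w_k)$ of nonempty words, a weak sentence may also contain empty words. $|I|$ is the total number of letters, $\ell(I)=k$. Let $x_{a,i}$ ($a\in A$, $i\in\mathbb{Z}_{>0}$) be variables subject only to the relations $x_{a,i}x_{b,j}=x_{b,j}x_{a,i}$ for $i\neq j$ (variables with the same second index and different colors do not commute). For a word $w=c_1\cdots c_r$ put $x_{w,i}=x_{c_1,i}\cdots x_{c_r,i}$ and $x_{\emptyset,i}=1$. For a sentence $I=(w_1,\dots,w_k)$, the colored monomial quasisymmetric function is $M_I=\sum_{1\le j_1<\dots<j_k}x_{w_1,j_1}\cdots x_{w_k,j_k}$. For a sentence $J=(w_1,\dots,w_k)$ the colored composition diagram of shape $J$ has $k$ left-justified rows (row 1 on top), row $i$ having $|w_i|$ boxes, the $j$-th box of row $i$ colored by the $j$-th letter of $w_i$. A colored immaculate tableau (CIT) of shape $J$ is a filling of the boxes of this diagram by positive integers such that entries weakly increase from left to right in each row and strictly increase from top to bottom in the first column. The type of a CIT $T$ is the weak sentence $B=(u_1,\dots,u_m)$ ($m$ the largest entry) where $u_i$ is the word of colors of the boxes containing $i$, read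 row by row from the lowest row to the highest row and from left to right within each row ($u_i=\emptyset$ if no box contains $i$). Set $x_T=x_{u_1,1}x_{u_2,2}\cdots x_{u_m,m}$. The colored dual immaculate function is $\mathfrak{S}^*_J=\sum_T x_T$, summed over all CIT $T$ of shape $J$. -}

module Defs where

open import Data.Nat using (ℕ; zero; suc; _+_; _*_; _≤_; _<_; _≤?_; _<?_)
open import Data.Fin using (Fin)
import Data.Fin.Properties as FinP
open import Data.Nat.ListAction using (sum)
open import Data.List using (List; []; _∷_; [_]; map; concat; concatMap; length; filter; reverse; foldr; upTo; allFin; _++_)
open import Data.List.Properties using (≡-dec)
open import Data.List.Relation.Unary.All using (All; all?)
open import Data.List.Relation.Unary.Linked using (Linked; linked?)
open import Data.Product using (_×_; _,_; proj₁; proj₂)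
open import Data.Unit using (⊤)
open import Relation.Binary.PropositionalEquality using (_≡_; _≢_)
open import Relation.Nullary using (Dec; yes; no; ¬_)
open import Relation.Nullary.Decidable using (_×-dec_; ¬?)

Word : ℕ → Set
Word k = List (Fin k)

WeakSentence : ℕ → Set
WeakSentence k = List (Word k)

NonEmptyWord : {k : ℕ} → Word k → Set
NonEmptyWord w = w ≢ []

IsSentence : {k : ℕ} → WeakSentence k → Set
IsSentence I = All NonEmptyWord I

size : {k : ℕ} → WeakSentence k → ℕ
size I = sum (map length I)

_≟W_ : {k : ℕ} → (u v : WeakSentence k) → Dec (u ≡ v)
_≟W_ = ≡-dec (≡-dec FinP._≟_)

-- Since variables with distinct second index commute and variables with
-- the same index do not, every monomial has a unique normal form
-- x_{u_1,1} x_{u_2,2} ... x_{u_m,m} with u_m nonempty (or m = 0);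
-- we represent it by the weak sentence (u_1,...,u_m) without trailing
-- empty words.

NoTrailingEmpty : {k : ℕ} → WeakSentence k → Set
NoTrailingEmpty [] = ⊤
NoTrailingEmpty (w ∷ []) = NonEmptyWord w
NoTrailingEmpty (w ∷ v ∷ ws) = NoTrailingEmpty (v ∷ ws)

-- A formal power series with ℕ-coefficients is given by its coefficient
-- on each monomial (normal form W with NoTrailingEmpty W).
Series : ℕ → Set
Series k = WeakSentence k → ℕ

dropEmpty : {k : ℕ} → WeakSentence k → WeakSentence k
dropEmpty [] = []
dropEmpty ([] ∷ ws) = dropEmpty ws
dropEmpty ((c ∷ w) ∷ ws) = (c ∷ w) ∷ dropEmpty ws

-- The monomial x_{w_1,j_1}...x_{w_k,j_k} (j_1<...<j_k, all w_t nonempty)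
-- has normal form W with w_t in position j_t and empty words elsewhere;
-- hence the coefficient of the monomial W in M_I is 1 iff the nonempty
-- words of W, in order, form I.
M : {k : ℕ} → WeakSentence k → Series k
M I W with dropEmpty W ≟W I
... | yes _ = 1
... | no _ = 0

Tableau : ℕ → Set
Tableau k = List (List (Fin k × ℕ))

shape : {k : ℕ} → Tableau k → WeakSentence k
shape T = map (map proj₁) T

entries : {k : ℕ} → List (Fin k × ℕ) → List ℕ
entries r = map proj₂ r

firstColumn : {k : ℕ} → Tableau k → List ℕ
firstColumn [] = []
firstColumn ([] ∷ T) = firstColumn T
firstColumn ((b ∷ r) ∷ T) = proj₂ b ∷ firstColumn T

-- CIT: positive entries, rows weakly increasing, first column strictly
-- increasing top to bottom (row 1 = head of the list = top row).
IsCIT : {k : ℕ} → Tableau k → Set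
IsCIT T = All (λ r → All (λ e → 1 ≤ e) (entries r)) T
        × All (λ r → Linked _≤_ (entries r)) T
        × Linked _<_ (firstColumn T)

isCIT? : {k : ℕ} → (T : Tableau k) → Dec (IsCIT T)
isCIT? T = all? (λ r → all? (λ e → 1 ≤? e) (entries r)) T
      ×-dec (all? (λ r → linked? _≤?_ (entries r)) T
      ×-dec linked? _<?_ (firstColumn T))

maxEntry : {k : ℕ} → Tableau k → ℕ
maxEntry T = foldr Data.Nat._⊔_ 0 (concat (map entries T))
  where import Data.Nat

-- colors of boxes containing i, rows read from the lowest row to the
-- highest, left to right within each row
colorsWith : {k : ℕ} → Tableau k → ℕ → Word k
colorsWith T i = concatMap (λ r → concatMap (λ b → pick b) r) (reverse T)
  where
  pick : _ → Word _
  pick (c , e) with e Data.Nat.≟ i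
    where import Data.Nat
  ... | yes _ = [ c ]
  ... | no _ = []

typeOf : {k : ℕ} → Tableau k → WeakSentence k
typeOf T = map (λ i → colorsWith T (suc i)) (upTo (maxEntry T))

range1 : ℕ → List ℕ
range1 N = map suc (upTo N)

fillWord : {k : ℕ} → Word k → ℕ → List (List (Fin k × ℕ))
fillWord [] N = [ [] ]
fillWord (c ∷ w) N = concatMap (λ e → map ((c , e) ∷_) (fillWord w N)) (range1 N)

fillings : {k : ℕ} → WeakSentence k → ℕ → List (Tableau k)
fillings [] N = [ [] ]
fillings (w ∷ J) N = concatMap (λ r → map (r ∷_) (fillings J N)) (fillWord w N)

-- number of CIT of shape J and (weak) type W.  A CIT of type W has
-- largest entry length W, so all its entries lie in {1,...,length W}
-- and it occurs exactly once in  fillings J (length W).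
countCIT : {k : ℕ} → WeakSentence k → WeakSentence k → ℕ
countCIT J W =
  length (filter (λ T → isCIT? T ×-dec (typeOf T ≟W W)) (fillings J (length W)))

K : {k : ℕ} → WeakSentence k → WeakSentence k → ℕ
K J B = countCIT J B

-- Colored dual immaculate function: sum of x_T over all CIT of shape J;
-- its coefficient at the monomial with normal form W is the number of
-- CIT of shape J whose type is W.
dualImm : {k : ℕ} → WeakSentence k → Series k
dualImm J W = countCIT J W

compositions : ℕ → List (List ℕ)
compositions zero = [ [] ]
compositions (suc n) = concatMap (λ c → (1 ∷ c) ∷ bump c) (compositions n)
  where
  bump : List ℕ → List (List ℕ)
  bump [] = []
  bump (a ∷ c) = [ suc a ∷ c ]

wordsOfLength : (k ℓ : ℕ) → List (Word k)
wordsOfLength k zero = [ [] ]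
wordsOfLength k (suc ℓ) = concatMap (λ c → map (c ∷_) (wordsOfLength k ℓ)) (allFin k)

sentencesWithShape : (k : ℕ) → List ℕ → List (WeakSentence k)
sentencesWithShape k [] = [ [] ]
sentencesWithShape k (a ∷ c) =
  concatMap (λ w → map (w ∷_) (sentencesWithShape k c)) (wordsOfLength k a)

sentencesOfSize : (k n : ℕ) → List (WeakSentence k)
sentencesOfSize k n = concatMap (sentencesWithShape k) (compositions n)

lincomb : {k : ℕ} → List (WeakSentence k) → (WeakSentence k → ℕ)
        → (WeakSentence k → Series k) → Series k
lincomb Bs c F W = sum (map (λ B → c B * F B W) Bs)

-- On the right, at a monomial W only B = dropEmpty W contributes, and it is one of the summands
-- exactly when |W| = |J|, since sentencesOfSize lists every sentence of that size once. On the
-- left, the coefficient is the number of CITs of shape J and type W. If |W| ≠ |J| there are none,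
-- because the type of a tableau records every box exactly once. Otherwise the empty words of W
-- are removed one at a time: if the (a+1)-th word of the type is empty, no box holds a+1, and
-- lowering all entries above a+1 by one is a bijection onto the CITs of the shortened type, since
-- it is strictly monotone and the CIT conditions only compare entries.

module Submission where

open import Defs
open import Data.Bool as Bool using (Bool; true; false; _∧_)
open import Data.Bool.ListAction using (all)
open import Data.Bool.Properties using (∧-zeroʳ)
open import Data.Empty using (⊥-elim)
open import Data.Fin using (Fin)
import Data.Fin.Properties as FinP
open import Data.List
  using (List; []; _∷_; [_]; map; concat; concatMap; length; _++_; _∷ʳ_; reverse; foldr; applyUpTo;
         tabulate; allFin; filter; filterᵇ)
open import Data.List.Properties
  using (≡-dec; map-++; map-cong; map-cong-local; map-id; map-∘; map-tabulate; map-applyUpTo; concat-map;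
         concatMap-++; length-map; length-++; reverse-map; ++-identityʳ; ++-assoc; ∷-injectiveˡ; ∷-injectiveʳ;
         filter-++; filter-all; filter-none; filter-reject)
open import Data.List.Relation.Unary.All as All using (All; []; _∷_)
import Data.List.Relation.Unary.All.Properties as AllP
open import Data.List.Relation.Unary.Any as Any using (Any; here; there)
import Data.List.Relation.Unary.Any.Properties as AnyP
open import Data.List.Relation.Unary.Linked as Linked using (Linked)
import Data.List.Relation.Unary.Linked.Properties as LinkedP
open import Data.List.Relation.Binary.Permutation.Propositional using (↭-sym)
open import Data.List.Relation.Binary.Permutation.Propositional.Properties using (↭-reverse; All-resp-↭)
open import Data.Nat as ℕ using (ℕ; zero; suc; _+_; _*_; _≡ᵇ_; _≤_; _<_; _⊔_; z≤n; s≤s)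
import Data.Nat.Properties as ℕP
open import Algebra.Properties.CommutativeSemigroup ℕP.+-commutativeSemigroup using (interchange)
open import Data.Nat.ListAction using (sum)
open import Data.Nat.ListAction.Properties using (sum-++; sum-↭)
open import Data.Product using (_×_; _,_; proj₁; proj₂; map₁; map₂)
open import Data.Product.Function.NonDependent.Propositional using (_×-⇔_)
open import Data.Sum using (inj₁; inj₂)
open import Function using (id; _∘_)
open import Function.Bundles using (_⇔_; mk⇔; Equivalence)
open import Function.Definitions using (Injective)
open import Relation.Binary.Core using (_Preserves_⟶_)
open import Relation.Binary.Definitions using (DecidableEquality; tri<; tri≈; tri>)
open import Relation.Binary.PropositionalEquality hiding ([_])
open import Relation.Nullary using (yes; no; does)
open import Relation.Nullary.Decidable
  using (dec-true; dec-false; T?; _×-dec_; isNo; toWitnessFalse; fromWitnessFalse)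
open import Relation.Unary using (Decidable; _⊆_)

private
  variable
    A B : Set

-- Multiplicities and filters in lists

𝟙 : Bool → ℕ
𝟙 true = 1
𝟙 false = 0

𝟙-∧ : ∀ a b → 𝟙 (a ∧ b) ≡ 𝟙 a * 𝟙 b
𝟙-∧ true true = refl
𝟙-∧ true false = refl
𝟙-∧ false b = refl

sum-map-zero : (xs : List A) → sum (map (λ _ → 0) xs) ≡ 0
sum-map-zero [] = refl
sum-map-zero (_ ∷ xs) = sum-map-zero xs

sum-map-+ : (f g : A → ℕ) (xs : List A) →
  sum (map (λ x → f x + g x) xs) ≡ sum (map f xs) + sum (map g xs)
sum-map-+ f g [] = refl
sum-map-+ f g (x ∷ xs) rewrite sum-map-+ f g xs =
  interchange (f x) (g x) (sum (map f xs)) (sum (map g xs))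

sum-map-*ˡ : (r : ℕ) (f : A → ℕ) (xs : List A) → sum (map (λ x → r * f x) xs) ≡ r * sum (map f xs)
sum-map-*ˡ r f [] = sym (ℕP.*-zeroʳ r)
sum-map-*ˡ r f (x ∷ xs) rewrite sum-map-*ˡ r f xs = sym (ℕP.*-distribˡ-+ r (f x) _)

sum-map-*ʳ : (f : A → ℕ) (r : ℕ) (xs : List A) → sum (map (λ x → f x * r) xs) ≡ sum (map f xs) * r
sum-map-*ʳ f r [] = refl
sum-map-*ʳ f r (x ∷ xs) rewrite sum-map-*ʳ f r xs = sym (ℕP.*-distribʳ-+ r (f x) _)

prependEach : (A → B) → List A → List (List B) → List (List B)
prependEach h xs L = concatMap (λ x → map (h x ∷_) L) xs

multiplicity : DecidableEquality A → A → List A → ℕ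
multiplicity _≟_ x ys = sum (map (λ y → 𝟙 (does (x ≟ y))) ys)

module _ (_≟_ : DecidableEquality A) where

  multiplicity-++ : ∀ x xs ys →
    multiplicity _≟_ x (xs ++ ys) ≡ multiplicity _≟_ x xs + multiplicity _≟_ x ys
  multiplicity-++ x xs ys = trans (cong sum (map-++ _ xs ys)) (sum-++ (map _ xs) _)

  multiplicity-concatMap : ∀ x (g : B → List A) ys →
    multiplicity _≟_ x (concatMap g ys) ≡ sum (map (λ y → multiplicity _≟_ x (g y)) ys)
  multiplicity-concatMap x g [] = refl
  multiplicity-concatMap x g (y ∷ ys) =
    trans (multiplicity-++ x (g y) (concatMap g ys))
          (cong (multiplicity _≟_ x (g y) +_) (multiplicity-concatMap x g ys))

module _ (_≟_ : DecidableEquality A) where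

  private
    _≟*_ : DecidableEquality (List A)
    _≟*_ = ≡-dec _≟_

  multiplicity-map-∷ : ∀ x X y L →
    multiplicity _≟*_ (x ∷ X) (map (y ∷_) L) ≡ 𝟙 (does (x ≟ y)) * multiplicity _≟*_ X L
  multiplicity-map-∷ x X y [] = sym (ℕP.*-zeroʳ (𝟙 (does (x ≟ y))))
  multiplicity-map-∷ x X y (l ∷ L)
    rewrite multiplicity-map-∷ x X y L | 𝟙-∧ (does (x ≟ y)) (does (X ≟* l)) =
    sym (ℕP.*-distribˡ-+ (𝟙 (does (x ≟ y))) _ _)

  multiplicity-[]-map-∷ : ∀ y L → multiplicity _≟*_ [] (map (y ∷_) L) ≡ 0
  multiplicity-[]-map-∷ y [] = refl
  multiplicity-[]-map-∷ y (l ∷ L) = multiplicity-[]-map-∷ y L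

  multiplicity-prependEach : ∀ x X ys L →
    multiplicity _≟*_ (x ∷ X) (prependEach id ys L) ≡ multiplicity _≟_ x ys * multiplicity _≟*_ X L
  multiplicity-prependEach x X ys L = begin
      multiplicity _≟*_ (x ∷ X) (prependEach id ys L)
    ≡⟨ multiplicity-concatMap _≟*_ (x ∷ X) (λ y → map (y ∷_) L) ys ⟩
      sum (map (λ y → multiplicity _≟*_ (x ∷ X) (map (y ∷_) L)) ys)
    ≡⟨ cong sum (map-cong (λ y → multiplicity-map-∷ x X y L) ys) ⟩
      sum (map (λ y → 𝟙 (does (x ≟ y)) * multiplicity _≟*_ X L) ys)
    ≡⟨ sum-map-*ʳ (λ y → 𝟙 (does (x ≟ y))) _ ys ⟩
      multiplicity _≟_ x ys * multiplicity _≟*_ X L ∎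
    where open ≡-Reasoning

  multiplicity-[]-prependEach : ∀ ys L → multiplicity _≟*_ [] (prependEach id ys L) ≡ 0
  multiplicity-[]-prependEach ys L =
    trans (multiplicity-concatMap _≟*_ [] (λ y → map (y ∷_) L) ys)
          (trans (cong sum (map-cong (λ y → multiplicity-[]-map-∷ y L) ys))
                 (sum-map-zero ys))

filter-map : ∀ {P : B → Set} (P? : Decidable P) (f : A → B) xs →
  filter P? (map f xs) ≡ map f (filter (P? ∘ f) xs)
filter-map P? f [] = refl
filter-map P? f (x ∷ xs) with does (P? (f x))
... | true = cong (f x ∷_) (filter-map P? f xs)
... | false = filter-map P? f xs

filter-≐-local : ∀ {P Q : A → Set} (P? : Decidable P) (Q? : Decidable Q) {xs} →
  All (λ x → P x ⇔ Q x) xs → filter P? xs ≡ filter Q? xs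
filter-≐-local P? Q? [] = refl
filter-≐-local P? Q? {x ∷ xs} (P⇔Q ∷ ps) with P? x | Q? x
... | yes _ | yes _ = cong (x ∷_) (filter-≐-local P? Q? ps)
... | yes p | no ¬q = ⊥-elim (¬q (Equivalence.to P⇔Q p))
... | no ¬p | yes q = ⊥-elim (¬p (Equivalence.from P⇔Q q))
... | no _ | no _ = filter-≐-local P? Q? ps

filter-filter-⊆ : ∀ {P Q : A → Set} (P? : Decidable P) (Q? : Decidable Q) → P ⊆ Q →
  ∀ xs → filter P? (filter Q? xs) ≡ filter P? xs
filter-filter-⊆ P? Q? P⊆Q [] = refl
filter-filter-⊆ P? Q? P⊆Q (x ∷ xs) with Q? x
... | no ¬q = trans (filter-filter-⊆ P? Q? P⊆Q xs) (sym (filter-reject P? (¬q ∘ P⊆Q)))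
... | yes _ with does (P? x)
...   | true = cong (x ∷_) (filter-filter-⊆ P? Q? P⊆Q xs)
...   | false = filter-filter-⊆ P? Q? P⊆Q xs

filterᵇ-all-prependEach : ∀ (p : B → Bool) (h : A → B) xs L →
  filterᵇ (all p) (prependEach h xs L) ≡ prependEach h (filterᵇ (p ∘ h) xs) (filterᵇ (all p) L)
filterᵇ-all-prependEach p h [] L = refl
filterᵇ-all-prependEach p h (x ∷ xs) L with p (h x) in eq
... | true = trans (filter-++ (T? ∘ all p) (map (h x ∷_) L) _)
                   (cong₂ _++_ (accept L) (filterᵇ-all-prependEach p h xs L))
  where
  accept : ∀ L → filterᵇ (all p) (map (h x ∷_) L) ≡ map (h x ∷_) (filterᵇ (all p) L)
  accept [] = refl
  accept (l ∷ L) rewrite eq with all p l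
  ... | true = cong ((h x ∷ l) ∷_) (accept L)
  ... | false = accept L
... | false = trans (filter-++ (T? ∘ all p) (map (h x ∷_) L) _)
                    (cong₂ _++_ (reject L) (filterᵇ-all-prependEach p h xs L))
  where
  reject : ∀ L → filterᵇ (all p) (map (h x ∷_) L) ≡ []
  reject [] = refl
  reject (l ∷ L) rewrite eq = reject L

map-map-prependEach : ∀ (g : B → B) (h : A → B) (f : A → A) → (∀ x → g (h x) ≡ h (f x)) →
  ∀ xs L → map (map g) (prependEach h xs L) ≡ prependEach h (map f xs) (map (map g) L)
map-map-prependEach g h f g∘h≡h∘f [] L = refl
map-map-prependEach g h f g∘h≡h∘f (x ∷ xs) L =
  trans (map-++ (map g) (map (h x ∷_) L) _)
        (cong₂ _++_ (trans (sym (map-∘ L))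
                           (trans (map-cong (λ l → cong (_∷ map g l) (g∘h≡h∘f x)) L) (map-∘ L)))
                    (map-map-prependEach g h f g∘h≡h∘f xs L))

++-injective-length : ∀ (xs ys : List A) {xs′ ys′} → length xs ≡ length ys →
  xs ++ xs′ ≡ ys ++ ys′ → xs ≡ ys × xs′ ≡ ys′
++-injective-length [] [] _ eq = refl , eq
++-injective-length (x ∷ xs) (y ∷ ys) len eq with refl ← ∷-injectiveˡ eq =
  map₁ (cong (x ∷_)) (++-injective-length xs ys (ℕP.suc-injective len) (∷-injectiveʳ eq))

-- Segments g (s + 1), …, g (s + n) of a sequence

segment : (ℕ → A) → ℕ → ℕ → List A
segment g s zero = []
segment g s (suc n) = g (suc s) ∷ segment g (suc s) n

interval : ℕ → ℕ → List ℕ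
interval = segment id

segment-interval : ∀ (g : ℕ → A) s n → segment g s n ≡ map g (interval s n)
segment-interval g s zero = refl
segment-interval g s (suc n) = cong (g (suc s) ∷_) (segment-interval g (suc s) n)

interval-bounds : ∀ s n → All (λ i → s < i × i ≤ s + n) (interval s n)
interval-bounds s zero = []
interval-bounds s (suc n) =
  (ℕP.≤-refl , subst (suc s ≤_) (sym (ℕP.+-suc s n)) (s≤s (ℕP.m≤m+n s n)))
  ∷ All.map (λ {i} (s<i , i≤) → ℕP.<⇒≤ s<i , subst (i ≤_) (sym (ℕP.+-suc s n)) i≤)
            (interval-bounds (suc s) n)

segment-cong-local : ∀ (g h : ℕ → A) s n → (∀ i → s < i → i ≤ s + n → g i ≡ h i) →
  segment g s n ≡ segment h s n
segment-cong-local g h s n g≡h = begin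
    segment g s n         ≡⟨ segment-interval g s n ⟩
    map g (interval s n)  ≡⟨ map-cong-local (All.map (λ (s<i , i≤) → g≡h _ s<i i≤) (interval-bounds s n)) ⟩
    map h (interval s n)  ≡⟨ segment-interval h s n ⟨
    segment h s n         ∎
  where open ≡-Reasoning

length-segment : ∀ (g : ℕ → A) s n → length (segment g s n) ≡ n
length-segment g s zero = refl
length-segment g s (suc n) = cong suc (length-segment g (suc s) n)

segment-++ : ∀ (g : ℕ → A) s m n → segment g s (m + n) ≡ segment g s m ++ segment g (s + m) n
segment-++ g s zero n = cong (λ t → segment g t n) (sym (ℕP.+-identityʳ s))
segment-++ g s (suc m) n =
  cong (g (suc s) ∷_) (trans (segment-++ g (suc s) m n)
                             (cong (λ t → segment g (suc s) m ++ segment g t n) (sym (ℕP.+-suc s m))))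

segment-∷ʳ : ∀ (g : ℕ → A) n → segment g 0 (suc n) ≡ segment g 0 n ∷ʳ g (suc n)
segment-∷ʳ g n = trans (cong (segment g 0) (ℕP.+-comm 1 n)) (segment-++ g 0 n 1)

applyUpTo-segment : ∀ (f g : ℕ → A) s n → (∀ i → f i ≡ g (suc (s + i))) →
  applyUpTo f n ≡ segment g s n
applyUpTo-segment f g s zero f≡g = refl
applyUpTo-segment f g s (suc n) f≡g =
  cong₂ _∷_ (trans (f≡g 0) (cong (g ∘ suc) (ℕP.+-identityʳ s)))
            (applyUpTo-segment (f ∘ suc) g (suc s) n
              (λ i → trans (f≡g (suc i)) (cong (g ∘ suc) (ℕP.+-suc s i))))

range1-interval : ∀ N → range1 N ≡ interval 0 N
range1-interval N = trans (map-applyUpTo id suc N) (applyUpTo-segment suc id 0 N (λ _ → refl))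

segment-suc : ∀ (g : ℕ → A) s n → segment g (suc s) n ≡ segment (g ∘ suc) s n
segment-suc g s zero = refl
segment-suc g s (suc n) = cong (g (suc (suc s)) ∷_) (segment-suc g (suc s) n)

-- The monomial side

_≟ʷ_ : ∀ {k} → DecidableEquality (Word k)
_≟ʷ_ = ≡-dec FinP._≟_

_≟ᶜ_ : DecidableEquality (List ℕ)
_≟ᶜ_ = ≡-dec ℕ._≟_

multiplicity-allFin : ∀ {k} (x : Fin k) → multiplicity FinP._≟_ x (allFin k) ≡ 1
multiplicity-allFin {k} x =
  trans (cong sum (map-tabulate {n = k} id (λ y → 𝟙 (does (x FinP.≟ y))))) (sum-indicator x)
  where
  sum-zeros : ∀ m → sum (tabulate {n = m} (λ _ → 0)) ≡ 0
  sum-zeros zero = refl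
  sum-zeros (suc m) = sum-zeros m
  sum-indicator : ∀ {m} (x : Fin m) → sum (tabulate (λ y → 𝟙 (does (x FinP.≟ y)))) ≡ 1
  sum-indicator {suc m} Fin.zero = cong suc (sum-zeros m)
  sum-indicator {suc m} (Fin.suc x) = sum-indicator x

multiplicity-wordsOfLength : ∀ k (w : Word k) ℓ →
  multiplicity _≟ʷ_ w (wordsOfLength k ℓ) ≡ 𝟙 (length w ≡ᵇ ℓ)
multiplicity-wordsOfLength k [] zero = refl
multiplicity-wordsOfLength k (x ∷ w) zero = refl
multiplicity-wordsOfLength k [] (suc ℓ) =
  multiplicity-[]-prependEach FinP._≟_ (allFin k) (wordsOfLength k ℓ)
multiplicity-wordsOfLength k (x ∷ w) (suc ℓ) = begin
    multiplicity _≟ʷ_ (x ∷ w) (wordsOfLength k (suc ℓ))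
  ≡⟨ multiplicity-prependEach FinP._≟_ x w (allFin k) (wordsOfLength k ℓ) ⟩
    multiplicity FinP._≟_ x (allFin k) * multiplicity _≟ʷ_ w (wordsOfLength k ℓ)
  ≡⟨ cong₂ _*_ (multiplicity-allFin x) (multiplicity-wordsOfLength k w ℓ) ⟩
    1 * 𝟙 (length w ≡ᵇ ℓ)
  ≡⟨ ℕP.*-identityˡ _ ⟩
    𝟙 (length w ≡ᵇ ℓ) ∎
  where open ≡-Reasoning

multiplicity-sentencesWithShape : ∀ k (X : WeakSentence k) c →
  multiplicity _≟W_ X (sentencesWithShape k c) ≡ 𝟙 (does (map length X ≟ᶜ c))
multiplicity-sentencesWithShape k [] [] = refl
multiplicity-sentencesWithShape k (x ∷ X) [] = refl
multiplicity-sentencesWithShape k [] (a ∷ c) =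
  multiplicity-[]-prependEach _≟ʷ_ (wordsOfLength k a) (sentencesWithShape k c)
multiplicity-sentencesWithShape k (x ∷ X) (a ∷ c) = begin
    multiplicity _≟W_ (x ∷ X) (sentencesWithShape k (a ∷ c))
  ≡⟨ multiplicity-prependEach _≟ʷ_ x X (wordsOfLength k a) (sentencesWithShape k c) ⟩
    multiplicity _≟ʷ_ x (wordsOfLength k a) * multiplicity _≟W_ X (sentencesWithShape k c)
  ≡⟨ cong₂ _*_ (multiplicity-wordsOfLength k x a) (multiplicity-sentencesWithShape k X c) ⟩
    𝟙 (length x ≡ᵇ a) * 𝟙 (does (map length X ≟ᶜ c))
  ≡⟨ 𝟙-∧ (length x ≡ᵇ a) _ ⟨
    𝟙 (does (map length (x ∷ X) ≟ᶜ (a ∷ c))) ∎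
  where open ≡-Reasoning

allPositive : List ℕ → Bool
allPositive [] = true
allPositive (zero ∷ d) = false
allPositive (suc _ ∷ d) = allPositive d

isCompositionOf : List ℕ → ℕ → Bool
isCompositionOf d n = allPositive d ∧ (sum d ≡ᵇ n)

-- A composition of n+1 arises from one of n either by prepending a part 1
-- or by enlarging its first part.
multiplicity-compositions : ∀ d n → multiplicity _≟ᶜ_ d (compositions n) ≡ 𝟙 (isCompositionOf d n)
multiplicity-compositions [] zero = refl
multiplicity-compositions (zero ∷ d) zero = refl
multiplicity-compositions (suc a ∷ d) zero = cong 𝟙 (sym (∧-zeroʳ (allPositive d)))
multiplicity-compositions [] (suc n) =
  trans (multiplicity-concatMap _≟ᶜ_ [] _ (compositions n))
        (trans (cong sum (map-cong (λ { [] → refl ; (_ ∷ _) → refl }) (compositions n)))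
               (sum-map-zero (compositions n)))
multiplicity-compositions (zero ∷ d) (suc n) =
  trans (multiplicity-concatMap _≟ᶜ_ (zero ∷ d) _ (compositions n))
        (trans (cong sum (map-cong (λ { [] → refl ; (_ ∷ _) → refl }) (compositions n)))
               (sum-map-zero (compositions n)))
multiplicity-compositions (suc a ∷ d) (suc n) = begin
    multiplicity _≟ᶜ_ (suc a ∷ d) (compositions (suc n))
  ≡⟨ multiplicity-concatMap _≟ᶜ_ (suc a ∷ d) _ (compositions n) ⟩
    _
  ≡⟨ cong sum (map-cong (λ { [] → cong (_+ 0) (𝟙-∧ (a ≡ᵇ 0) (does (d ≟ᶜ [])))
                           ; (b ∷ c) → cong₂ _+_ (𝟙-∧ (a ≡ᵇ 0) (does (d ≟ᶜ (b ∷ c))))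
                                                 (ℕP.+-identityʳ _) })
                        (compositions n)) ⟩
    sum (map (λ c → 𝟙 (a ≡ᵇ 0) * 𝟙 (does (d ≟ᶜ c)) + 𝟙 (does ((a ∷ d) ≟ᶜ c))) (compositions n))
  ≡⟨ sum-map-+ _ _ (compositions n) ⟩
    sum (map (λ c → 𝟙 (a ≡ᵇ 0) * 𝟙 (does (d ≟ᶜ c))) (compositions n))
      + multiplicity _≟ᶜ_ (a ∷ d) (compositions n)
  ≡⟨ cong (_+ multiplicity _≟ᶜ_ (a ∷ d) (compositions n))
          (sum-map-*ˡ (𝟙 (a ≡ᵇ 0)) _ (compositions n)) ⟩
    𝟙 (a ≡ᵇ 0) * multiplicity _≟ᶜ_ d (compositions n)
      + multiplicity _≟ᶜ_ (a ∷ d) (compositions n)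
  ≡⟨ cong₂ (λ x y → 𝟙 (a ≡ᵇ 0) * x + y)
           (multiplicity-compositions d n) (multiplicity-compositions (a ∷ d) n) ⟩
    𝟙 (a ≡ᵇ 0) * 𝟙 (isCompositionOf d n) + 𝟙 (isCompositionOf (a ∷ d) n)
  ≡⟨ combine a ⟩
    𝟙 (isCompositionOf (suc a ∷ d) (suc n)) ∎
  where
  open ≡-Reasoning
  combine : ∀ a → 𝟙 (a ≡ᵇ 0) * 𝟙 (isCompositionOf d n) + 𝟙 (isCompositionOf (a ∷ d) n)
                ≡ 𝟙 (isCompositionOf (suc a ∷ d) (suc n))
  combine zero = trans (ℕP.+-identityʳ _) (ℕP.+-identityʳ _)
  combine (suc a) = refl

multiplicity-sentencesOfSize : ∀ k (X : WeakSentence k) n →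
  multiplicity _≟W_ X (sentencesOfSize k n) ≡ 𝟙 (isCompositionOf (map length X) n)
multiplicity-sentencesOfSize k X n =
  trans (multiplicity-concatMap _≟W_ X (sentencesWithShape k) (compositions n))
        (trans (cong sum (map-cong (multiplicity-sentencesWithShape k X) (compositions n)))
               (multiplicity-compositions (map length X) n))

M-indicator : ∀ {k} (B W : WeakSentence k) → M B W ≡ 𝟙 (does (dropEmpty W ≟W B))
M-indicator B W with dropEmpty W ≟W B
... | yes _ = refl
... | no _ = refl

lincomb-M : ∀ {k} (Bs : List (WeakSentence k)) (c : WeakSentence k → ℕ) W →
  lincomb Bs c M W ≡ c (dropEmpty W) * multiplicity _≟W_ (dropEmpty W) Bs
lincomb-M [] c W = sym (ℕP.*-zeroʳ (c (dropEmpty W)))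
lincomb-M (B ∷ Bs) c W rewrite lincomb-M Bs c W | M-indicator B W with dropEmpty W ≟W B
... | yes refl = sym (ℕP.*-distribˡ-+ (c B) 1 _)
... | no _ = cong (_+ c (dropEmpty W) * multiplicity _≟W_ (dropEmpty W) Bs) (ℕP.*-zeroʳ (c B))

allPositive-dropEmpty : ∀ {k} (W : WeakSentence k) → allPositive (map length (dropEmpty W)) ≡ true
allPositive-dropEmpty [] = refl
allPositive-dropEmpty ([] ∷ W) = allPositive-dropEmpty W
allPositive-dropEmpty ((c ∷ w) ∷ W) = allPositive-dropEmpty W

size-dropEmpty : ∀ {k} (W : WeakSentence k) → size (dropEmpty W) ≡ size W
size-dropEmpty [] = refl
size-dropEmpty ([] ∷ W) = size-dropEmpty W
size-dropEmpty ((c ∷ w) ∷ W) = cong (suc (length w) +_) (size-dropEmpty W)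

lincomb-sentencesOfSize-M : ∀ {k} n (c : WeakSentence k → ℕ) W →
  lincomb (sentencesOfSize k n) c M W ≡ c (dropEmpty W) * 𝟙 (size W ≡ᵇ n)
lincomb-sentencesOfSize-M {k} n c W =
  trans (lincomb-M (sentencesOfSize k n) c W)
        (cong (c (dropEmpty W) *_)
              (trans (multiplicity-sentencesOfSize k (dropEmpty W) n)
                     (cong 𝟙 (cong₂ _∧_ (allPositive-dropEmpty W) (cong (_≡ᵇ n) (size-dropEmpty W))))))

-- Reading words, types and sizes of tableaux

Box : ℕ → Set
Box k = Fin k × ℕ

AllEntries : ∀ {k} → (ℕ → Set) → Tableau k → Set
AllEntries P = All (All (P ∘ proj₂))

relabel : ∀ {k} → (ℕ → ℕ) → Tableau k → Tableau k
relabel f = map (map (map₂ f))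

readingWord : ∀ {k} → Tableau k → List (Box k)
readingWord T = concat (reverse T)

colorIf : ∀ {k} → ℕ → Box k → Word k
colorIf i (c , e) with e ℕ.≟ i
... | yes _ = c ∷ []
... | no _ = []

colorsAt : ∀ {k} → ℕ → List (Box k) → Word k
colorsAt i = concatMap (colorIf i)

colorsWith-readingWord : ∀ {k} (T : Tableau k) i → colorsWith T i ≡ colorsAt i (readingWord T)
colorsWith-readingWord {k} T i = readRows _ colorsWith-singleton (reverse T)
  where
  colorsWith-singleton : ∀ b → colorsWith ((b ∷ []) ∷ []) i ≡ colorIf i b
  colorsWith-singleton (c , e) with e ℕ.≟ i
  ... | yes _ = refl
  ... | no _ = refl
  -- p stands for the per-box function local to colorsWith, which cannot be named here
  readRows : (p : Box k → Word k) → (∀ b → (p b ++ []) ++ [] ≡ colorIf i b) →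
    ∀ R → concatMap (concatMap p) R ≡ colorsAt i (concat R)
  readRows p p≡ [] = refl
  readRows p p≡ (r ∷ R) =
    trans (cong₂ _++_ (cong concat (map-cong p≡colorIf r)) (readRows p p≡ R))
          (sym (concatMap-++ (colorIf i) r (concat R)))
    where
    p≡colorIf : ∀ b → p b ≡ colorIf i b
    p≡colorIf b = trans (sym (trans (++-identityʳ (p b ++ [])) (++-identityʳ (p b)))) (p≡ b)

readingWord-relabel : ∀ {k} f (T : Tableau k) → readingWord (relabel f T) ≡ map (map₂ f) (readingWord T)
readingWord-relabel f T = trans (cong concat (sym (reverse-map (map (map₂ f)) T))) (concat-map (reverse T))

colorsAt-relabel : ∀ {k} (f : ℕ → ℕ) {i j} → f j ≡ i → (∀ e → f e ≡ i → e ≡ j) →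
  (bs : List (Box k)) → colorsAt i (map (map₂ f) bs) ≡ colorsAt j bs
colorsAt-relabel f fj≡i fe≡i [] = refl
colorsAt-relabel f {i} {j} fj≡i fe≡i ((c , e) ∷ bs) with f e ℕ.≟ i | e ℕ.≟ j
... | yes _ | yes _ = cong (c ∷_) (colorsAt-relabel f fj≡i fe≡i bs)
... | yes p | no q = ⊥-elim (q (fe≡i e p))
... | no p | yes refl = ⊥-elim (p fj≡i)
... | no _ | no _ = colorsAt-relabel f fj≡i fe≡i bs

colorsAt-≡[] : ∀ {k} i (bs : List (Box k)) → All ((_≢ i) ∘ proj₂) bs → colorsAt i bs ≡ []
colorsAt-≡[] i [] [] = refl
colorsAt-≡[] i ((c , e) ∷ bs) (e≢i ∷ bs≢i) with e ℕ.≟ i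
... | yes e≡i = ⊥-elim (e≢i e≡i)
... | no _ = colorsAt-≡[] i bs bs≢i

colorsAt-≡[]⁻ : ∀ {k} i (bs : List (Box k)) → colorsAt i bs ≡ [] → All ((_≢ i) ∘ proj₂) bs
colorsAt-≡[]⁻ i [] _ = []
colorsAt-≡[]⁻ i ((c , e) ∷ bs) eq with e ℕ.≟ i
colorsAt-≡[]⁻ i ((c , e) ∷ bs) () | yes _
... | no e≢i = e≢i ∷ colorsAt-≡[]⁻ i bs eq

colorsAt-≢[] : ∀ {k} i (bs : List (Box k)) → colorsAt i bs ≢ [] → Any ((_≡ i) ∘ proj₂) bs
colorsAt-≢[] i [] ne = ⊥-elim (ne refl)
colorsAt-≢[] i ((c , e) ∷ bs) ne with e ℕ.≟ i
... | yes e≡i = here e≡i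
... | no _ = there (colorsAt-≢[] i bs ne)

length-colorsAt : ∀ {k} i (bs : List (Box k)) →
  length (colorsAt i bs) ≡ sum (map (λ b → 𝟙 (does (proj₂ b ℕ.≟ i))) bs)
length-colorsAt i [] = refl
length-colorsAt i ((c , e) ∷ bs) with e ℕ.≟ i
... | yes e≡i rewrite dec-true (e ℕ.≟ i) e≡i = cong suc (length-colorsAt i bs)
... | no e≢i rewrite dec-false (e ℕ.≟ i) e≢i = length-colorsAt i bs

typeOf-segment : ∀ {k} (T : Tableau k) → typeOf T ≡ segment (colorsWith T) 0 (maxEntry T)
typeOf-segment T = trans (map-applyUpTo id (colorsWith T ∘ suc) (maxEntry T))
                         (applyUpTo-segment _ (colorsWith T) 0 (maxEntry T) (λ _ → refl))

maxEntry-≤ : ∀ {k} N (T : Tableau k) → AllEntries (_≤ N) T → maxEntry T ≤ N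
maxEntry-≤ N T T≤N = foldr-⊔-≤ (AllP.concat⁺ (AllP.map⁺ (All.map AllP.map⁺ T≤N)))
  where
  foldr-⊔-≤ : ∀ {xs} → All (_≤ N) xs → foldr _⊔_ 0 xs ≤ N
  foldr-⊔-≤ [] = z≤n
  foldr-⊔-≤ (x≤N ∷ xs≤N) = ℕP.⊔-lub x≤N (foldr-⊔-≤ xs≤N)

≤-maxEntry : ∀ {k} N (T : Tableau k) → Any ((_≡ N) ∘ proj₂) (readingWord T) → N ≤ maxEntry T
≤-maxEntry N T N∈T =
  ≤-foldr-⊔ (AnyP.concat⁺ (AnyP.map⁺ (Any.map AnyP.map⁺
              (AnyP.reverse⁻ {xs = T} (AnyP.concat⁻ (reverse T) N∈T)))))
  where
  ≤-foldr-⊔ : ∀ {xs} → Any (_≡ N) xs → N ≤ foldr _⊔_ 0 xs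
  ≤-foldr-⊔ {x ∷ xs} (here refl) = ℕP.m≤m⊔n x _
  ≤-foldr-⊔ {x ∷ xs} (there N∈xs) = ℕP.≤-trans (≤-foldr-⊔ N∈xs) (ℕP.m≤n⊔m x _)

NoTrailingEmpty-++⁻ : ∀ {k} (X : WeakSentence k) {y Y} →
  NoTrailingEmpty (X ++ y ∷ Y) → NoTrailingEmpty (y ∷ Y)
NoTrailingEmpty-++⁻ [] nte = nte
NoTrailingEmpty-++⁻ (x ∷ []) nte = nte
NoTrailingEmpty-++⁻ (x ∷ x′ ∷ X) nte = NoTrailingEmpty-++⁻ (x′ ∷ X) nte

NoTrailingEmpty-++⁺ : ∀ {k} (X : WeakSentence k) {y Y} →
  NoTrailingEmpty (y ∷ Y) → NoTrailingEmpty (X ++ y ∷ Y)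
NoTrailingEmpty-++⁺ [] nte = nte
NoTrailingEmpty-++⁺ (x ∷ []) nte = nte
NoTrailingEmpty-++⁺ (x ∷ x′ ∷ X) nte = NoTrailingEmpty-++⁺ (x′ ∷ X) nte

NoTrailingEmpty-drop : ∀ {k} (X Y : WeakSentence k) →
  NoTrailingEmpty (X ++ [] ∷ Y) → NoTrailingEmpty (X ++ Y)
NoTrailingEmpty-drop X [] nte = ⊥-elim (NoTrailingEmpty-++⁻ X nte refl)
NoTrailingEmpty-drop X (y ∷ Y) nte = NoTrailingEmpty-++⁺ X (NoTrailingEmpty-++⁻ X nte)

-- The last word of the type is nonempty, so the bound N is attained.
maxEntry-≡ : ∀ {k} N (T : Tableau k) → AllEntries (_≤ N) T →
  NoTrailingEmpty (segment (colorsWith T) 0 N) → maxEntry T ≡ N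
maxEntry-≡ zero T T≤0 _ = ℕP.n≤0⇒n≡0 (maxEntry-≤ 0 T T≤0)
maxEntry-≡ (suc n) T T≤N nte = ℕP.≤-antisym (maxEntry-≤ (suc n) T T≤N) (≤-maxEntry (suc n) T N∈T)
  where
  N∈T : Any ((_≡ suc n) ∘ proj₂) (readingWord T)
  N∈T = colorsAt-≢[] (suc n) (readingWord T) λ eq →
    NoTrailingEmpty-++⁻ (segment (colorsWith T) 0 n)
      (subst NoTrailingEmpty (segment-∷ʳ (colorsWith T) n) nte)
      (trans (colorsWith-readingWord T (suc n)) eq)

typeOf-from-segment : ∀ {k} N (T : Tableau k) W → AllEntries (_≤ N) T → NoTrailingEmpty W →
  segment (colorsWith T) 0 N ≡ W → typeOf T ≡ W
typeOf-from-segment N T W T≤N nte eq =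
  trans (typeOf-segment T)
        (trans (cong (segment (colorsWith T) 0)
                     (maxEntry-≡ N T T≤N (subst NoTrailingEmpty (sym eq) nte)))
               eq)

segment-from-typeOf : ∀ {k} (T : Tableau k) W → typeOf T ≡ W → segment (colorsWith T) 0 (length W) ≡ W
segment-from-typeOf T W refl =
  trans (cong (segment (colorsWith T) 0) length-typeOf) (sym (typeOf-segment T))
  where
  length-typeOf : length (typeOf T) ≡ maxEntry T
  length-typeOf = trans (cong length (typeOf-segment T)) (length-segment (colorsWith T) 0 (maxEntry T))

segment-from-typeOf-++ : ∀ {k} (T : Tableau k) W₁ W₂ → typeOf T ≡ W₁ ++ W₂ →
  segment (colorsWith T) 0 (length W₁) ≡ W₁ × segment (colorsWith T) (length W₁) (length W₂) ≡ W₂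
segment-from-typeOf-++ T W₁ W₂ eq =
  ++-injective-length (segment g 0 (length W₁)) W₁ (length-segment g 0 (length W₁))
    (trans (sym (segment-++ g 0 (length W₁) (length W₂)))
           (trans (cong (segment g 0) (sym (length-++ W₁))) (segment-from-typeOf T _ eq)))
  where g = colorsWith T

InRange : ℕ → ℕ → Set
InRange N e = 1 ≤ e × e ≤ N

range1-inRange : ∀ N → All (InRange N) (range1 N)
range1-inRange N = subst (All (InRange N)) (sym (range1-interval N)) (interval-bounds 0 N)

fillWord-sound : ∀ {k} (w : Word k) N →
  All (λ r → map proj₁ r ≡ w × All (InRange N ∘ proj₂) r) (fillWord w N)
fillWord-sound [] N = (refl , []) ∷ []
fillWord-sound (c ∷ w) N = AllP.concat⁺ (AllP.map⁺ (All.map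
  (λ e∈N → AllP.map⁺ (All.map (λ (r≡w , r∈N) → cong (c ∷_) r≡w , e∈N ∷ r∈N)
                                (fillWord-sound w N)))
  (range1-inRange N)))

fillings-sound : ∀ {k} (J : WeakSentence k) N →
  All (λ T → shape T ≡ J × AllEntries (InRange N) T) (fillings J N)
fillings-sound [] N = (refl , []) ∷ []
fillings-sound (w ∷ J) N = AllP.concat⁺ (AllP.map⁺ (All.map
  (λ (r≡w , r∈N) → AllP.map⁺ (All.map (λ (T≡J , T∈N) → cong₂ _∷_ r≡w T≡J , r∈N ∷ T∈N)
                                       (fillings-sound J N)))
  (fillWord-sound w N)))

sum-segment-≟-below : ∀ e s n → e ≤ s → sum (segment (λ j → 𝟙 (does (e ℕ.≟ j))) s n) ≡ 0
sum-segment-≟-below e s zero e≤s = refl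
sum-segment-≟-below e s (suc n) e≤s
  rewrite dec-false (e ℕ.≟ suc s) (ℕP.<⇒≢ (s≤s e≤s)) =
  sum-segment-≟-below e (suc s) n (ℕP.m≤n⇒m≤1+n e≤s)

sum-segment-≟-within : ∀ e s n → s < e → e ≤ s + n →
  sum (segment (λ j → 𝟙 (does (e ℕ.≟ j))) s n) ≡ 1
sum-segment-≟-within e s zero s<e e≤s+0 =
  ⊥-elim (ℕP.<⇒≱ s<e (subst (e ≤_) (ℕP.+-identityʳ s) e≤s+0))
sum-segment-≟-within e s (suc n) s<e e≤ with e ℕ.≟ suc s
... | yes refl rewrite dec-true (suc s ℕ.≟ suc s) refl =
  cong suc (sum-segment-≟-below (suc s) (suc s) n ℕP.≤-refl)
... | no e≢1+s rewrite dec-false (e ℕ.≟ suc s) e≢1+s =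
  sum-segment-≟-within e (suc s) n (ℕP.≤∧≢⇒< s<e (e≢1+s ∘ sym)) (subst (e ≤_) (ℕP.+-suc s n) e≤)

size-segment-colorsAt : ∀ {k} (bs : List (Box k)) s n →
  size (segment (λ j → colorsAt j bs) s n)
    ≡ sum (map (λ b → sum (segment (λ j → 𝟙 (does (proj₂ b ℕ.≟ j))) s n)) bs)
size-segment-colorsAt bs s zero = sym (sum-map-zero bs)
size-segment-colorsAt bs s (suc n) =
  trans (cong₂ _+_ (length-colorsAt (suc s) bs) (size-segment-colorsAt bs (suc s) n))
        (sym (sum-map-+ (λ b → 𝟙 (does (proj₂ b ℕ.≟ suc s))) _ bs))

length-concat : (R : List (List A)) → length (concat R) ≡ sum (map length R)
length-concat [] = refl
length-concat (r ∷ R) = trans (length-++ r) (cong (length r +_) (length-concat R))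

length-readingWord : ∀ {k} (T : Tableau k) → length (readingWord T) ≡ size (shape T)
length-readingWord T = begin
    length (concat (reverse T))         ≡⟨ length-concat (reverse T) ⟩
    sum (map length (reverse T))        ≡⟨ cong sum (reverse-map length T) ⟩
    sum (reverse (map length T))        ≡⟨ sum-↭ (↭-reverse (map length T)) ⟩
    sum (map length T)                  ≡⟨ cong sum (map-cong (λ r → sym (length-map proj₁ r)) T) ⟩
    sum (map (length ∘ map proj₁) T)    ≡⟨ cong sum (map-∘ T) ⟩
    size (shape T)                      ∎
  where open ≡-Reasoning

size-segment-colorsWith : ∀ {k} N (T : Tableau k) → AllEntries (InRange N) T →
  size (segment (colorsWith T) 0 N) ≡ size (shape T)
size-segment-colorsWith N T T∈N = begin
    size (segment (colorsWith T) 0 N)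
  ≡⟨ cong size (segment-cong-local _ _ 0 N (λ j _ _ → colorsWith-readingWord T j)) ⟩
    size (segment (λ j → colorsAt j (readingWord T)) 0 N)
  ≡⟨ size-segment-colorsAt (readingWord T) 0 N ⟩
    sum (map (λ b → sum (segment (λ j → 𝟙 (does (proj₂ b ℕ.≟ j))) 0 N)) (readingWord T))
  ≡⟨ each-box-counted-once (AllP.concat⁺ (All-resp-↭ (↭-sym (↭-reverse T)) T∈N)) ⟩
    length (readingWord T)
  ≡⟨ length-readingWord T ⟩
    size (shape T) ∎
  where
  open ≡-Reasoning
  each-box-counted-once : ∀ {bs} → All (InRange N ∘ proj₂) bs →
    sum (map (λ b → sum (segment (λ j → 𝟙 (does (proj₂ b ℕ.≟ j))) 0 N)) bs) ≡ length bs
  each-box-counted-once [] = refl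
  each-box-counted-once {(c , e) ∷ _} ((1≤e , e≤N) ∷ bs∈N) =
    cong₂ _+_ (sum-segment-≟-within e 0 N 1≤e e≤N) (each-box-counted-once bs∈N)


countCIT-size : ∀ {k} (J W : WeakSentence k) → size W ≢ size J → countCIT J W ≡ 0
countCIT-size J W W≢J = cong length (filter-none _ (All.map (λ {T} (shape≡J , T∈W) (_ , type≡W) →
  W≢J (trans (cong size (sym (segment-from-typeOf T W type≡W)))
             (trans (size-segment-colorsWith (length W) T T∈W) (cong size shape≡J))))
  (fillings-sound J (length W))))

-- Closing a gap in the entries

module StrictlyMonotone {f : ℕ → ℕ} (f-mono : f Preserves _<_ ⟶ _<_) where

  reflects-< : ∀ {x y} → f x < f y → x < y
  reflects-< {x} {y} fx<fy with ℕP.<-cmp x y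
  ... | tri< x<y _ _ = x<y
  ... | tri≈ _ refl _ = ⊥-elim (ℕP.<-irrefl refl fx<fy)
  ... | tri> _ _ y<x = ⊥-elim (ℕP.<-asym fx<fy (f-mono y<x))

  preserves-≤ : f Preserves _≤_ ⟶ _≤_
  preserves-≤ x≤y with ℕP.m≤n⇒m<n∨m≡n x≤y
  ... | inj₁ x<y = ℕP.<⇒≤ (f-mono x<y)
  ... | inj₂ refl = ℕP.≤-refl

  reflects-≤ : ∀ {x y} → f x ≤ f y → x ≤ y
  reflects-≤ fx≤fy = ℕP.≮⇒≥ (λ y<x → ℕP.<⇒≱ (f-mono y<x) fx≤fy)

  injective : Injective _≡_ _≡_ f
  injective fx≡fy =
    ℕP.≤-antisym (reflects-≤ (ℕP.≤-reflexive fx≡fy)) (reflects-≤ (ℕP.≤-reflexive (sym fx≡fy)))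

entries-relabel : ∀ {k} (f : ℕ → ℕ) (r : List (Box k)) →
  entries (map (map₂ f) r) ≡ map f (entries r)
entries-relabel f r = trans (sym (map-∘ r)) (map-∘ r)

firstColumn-relabel : ∀ {k} (f : ℕ → ℕ) (T : Tableau k) →
  firstColumn (relabel f T) ≡ map f (firstColumn T)
firstColumn-relabel f [] = refl
firstColumn-relabel f ([] ∷ T) = firstColumn-relabel f T
firstColumn-relabel f ((b ∷ r) ∷ T) = cong (f (proj₂ b) ∷_) (firstColumn-relabel f T)

-- The CIT conditions only compare entries with each other and with 0.
IsCIT-relabel : ∀ {k} {f : ℕ → ℕ} → f Preserves _<_ ⟶ _<_ → f 0 ≡ 0 →
  (T : Tableau k) → IsCIT (relabel f T) ⇔ IsCIT T
IsCIT-relabel {f = f} f-mono f0≡0 T = mk⇔ from to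
  where
  open StrictlyMonotone f-mono
  positive⁺ : ∀ {x} → 1 ≤ x → 1 ≤ f x
  positive⁺ {x} 0<x = subst (_< f x) f0≡0 (f-mono 0<x)
  positive⁻ : ∀ {x} → 1 ≤ f x → 1 ≤ x
  positive⁻ {x} 0<fx = reflects-< (subst (_< f x) (sym f0≡0) 0<fx)
  to : IsCIT T → IsCIT (relabel f T)
  to (pos , rows , col) =
    AllP.map⁺ (All.map (λ {r} p → subst (All (1 ≤_)) (sym (entries-relabel f r))
                                         (AllP.map⁺ (All.map positive⁺ p))) pos) ,
    AllP.map⁺ (All.map (λ {r} l → subst (Linked _≤_) (sym (entries-relabel f r))
                                         (LinkedP.map⁺ (Linked.map preserves-≤ l))) rows) ,
    subst (Linked _<_) (sym (firstColumn-relabel f T)) (LinkedP.map⁺ (Linked.map f-mono col))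
  from : IsCIT (relabel f T) → IsCIT T
  from (pos , rows , col) =
    All.map (λ {r} p → All.map positive⁻ (AllP.map⁻ (subst (All (1 ≤_)) (entries-relabel f r) p)))
            (AllP.map⁻ pos) ,
    All.map (λ {r} l → Linked.map reflects-≤ (LinkedP.map⁻ (subst (Linked _≤_) (entries-relabel f r) l)))
            (AllP.map⁻ rows) ,
    Linked.map reflects-< (LinkedP.map⁻ (subst (Linked _<_) (firstColumn-relabel f T) col))

-- skip a is the order embedding of ℕ onto ℕ ∖ {a + 1}
skip : ℕ → ℕ → ℕ
skip a zero = zero
skip zero (suc e) = suc (suc e)
skip (suc a) (suc e) = suc (skip a e)

skip-≤ : ∀ {a e} → e ≤ a → skip a e ≡ e
skip-≤ {a} {zero} _ = refl
skip-≤ {suc a} {suc e} (s≤s e≤a) = cong suc (skip-≤ e≤a)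

skip-> : ∀ {a e} → a < e → skip a e ≡ suc e
skip-> {zero} {suc e} _ = refl
skip-> {suc a} {suc e} (s≤s a<e) = cong suc (skip-> a<e)

skip-mono : ∀ a → skip a Preserves _<_ ⟶ _<_
skip-mono zero {zero} {suc y} _ = s≤s z≤n
skip-mono (suc a) {zero} {suc y} _ = s≤s z≤n
skip-mono zero {suc x} {suc y} (s≤s x<y) = s≤s (s≤s x<y)
skip-mono (suc a) {suc x} {suc y} (s≤s x<y) = s≤s (skip-mono a x<y)

skip-≢ : ∀ a e → skip a e ≢ suc a
skip-≢ a e with e ℕ.≤? a
... | yes e≤a = λ eq → ℕP.<⇒≢ (s≤s e≤a) (trans (sym (skip-≤ e≤a)) eq)
... | no e≰a = λ eq →
  ℕP.<⇒≢ (ℕP.≰⇒> e≰a) (sym (ℕP.suc-injective (trans (sym (skip-> (ℕP.≰⇒> e≰a))) eq)))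

skip-injective : ∀ a → Injective _≡_ _≡_ (skip a)
skip-injective a = StrictlyMonotone.injective (skip-mono a)

colorsWith-relabel : ∀ {k} {f : ℕ → ℕ} → Injective _≡_ _≡_ f →
  ∀ (T : Tableau k) j → colorsWith (relabel f T) (f j) ≡ colorsWith T j
colorsWith-relabel {f = f} f-inj T j = begin
    colorsWith (relabel f T) (f j)                 ≡⟨ colorsWith-readingWord (relabel f T) (f j) ⟩
    colorsAt (f j) (readingWord (relabel f T))      ≡⟨ cong (colorsAt (f j)) (readingWord-relabel f T) ⟩
    colorsAt (f j) (map (map₂ f) (readingWord T))   ≡⟨ colorsAt-relabel f refl (λ _ → f-inj) (readingWord T) ⟩
    colorsAt j (readingWord T)                      ≡⟨ colorsWith-readingWord T j ⟨
    colorsWith T j                                  ∎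
  where open ≡-Reasoning

colorsWith-relabel-∉ : ∀ {k} {f : ℕ → ℕ} {i} → (∀ e → f e ≢ i) →
  ∀ (T : Tableau k) → colorsWith (relabel f T) i ≡ []
colorsWith-relabel-∉ {f = f} {i} i∉f T =
  trans (colorsWith-readingWord (relabel f T) i)
        (trans (cong (colorsAt i) (readingWord-relabel f T))
               (colorsAt-≡[] i _ (AllP.map⁺ (All.universal (i∉f ∘ proj₂) (readingWord T)))))

segment-colorsWith-relabel-skip : ∀ {k} a b (T : Tableau k) →
  segment (colorsWith (relabel (skip a) T)) 0 (a + suc b)
    ≡ segment (colorsWith T) 0 a ++ [] ∷ segment (colorsWith T) a b
segment-colorsWith-relabel-skip a b T = begin
    segment g′ 0 (a + suc b)                             ≡⟨ segment-++ g′ 0 a (suc b) ⟩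
    segment g′ 0 a ++ g′ (suc a) ∷ segment g′ (suc a) b  ≡⟨ cong₂ _++_ lower (cong₂ _∷_ middle upper) ⟩
    segment g 0 a ++ [] ∷ segment g a b                  ∎
  where
  open ≡-Reasoning
  g′ = colorsWith (relabel (skip a) T)
  g = colorsWith T
  lower : segment g′ 0 a ≡ segment g 0 a
  lower = segment-cong-local g′ g 0 a λ i _ i≤a →
    trans (cong g′ (sym (skip-≤ i≤a))) (colorsWith-relabel (skip-injective a) T i)
  middle : g′ (suc a) ≡ []
  middle = colorsWith-relabel-∉ (skip-≢ a) T
  upper : segment g′ (suc a) b ≡ segment g a b
  upper = trans (segment-suc g′ a b) (segment-cong-local (g′ ∘ suc) g a b λ i a<i _ →
    trans (cong g′ (sym (skip-> a<i))) (colorsWith-relabel (skip-injective a) T i))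

AllEntries-relabel : ∀ {k} {P Q : ℕ → Set} {f : ℕ → ℕ} → (∀ {e} → P e → Q (f e)) →
  (T : Tableau k) → AllEntries P T → AllEntries Q (relabel f T)
AllEntries-relabel P⇒Q T T∈P = AllP.map⁺ (All.map (λ r∈P → AllP.map⁺ (All.map P⇒Q r∈P)) T∈P)

skip-≤-suc : ∀ a e → skip a e ≤ suc e
skip-≤-suc a zero = z≤n
skip-≤-suc zero (suc e) = ℕP.≤-refl
skip-≤-suc (suc a) (suc e) = s≤s (skip-≤-suc a e)

typeOf-relabel-skip : ∀ {k} (W₁ W₂ : WeakSentence k) (T : Tableau k) →
  AllEntries (_≤ length W₁ + length W₂) T → NoTrailingEmpty (W₁ ++ [] ∷ W₂) →
  (typeOf (relabel (skip (length W₁)) T) ≡ W₁ ++ [] ∷ W₂) ⇔ (typeOf T ≡ W₁ ++ W₂)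
typeOf-relabel-skip W₁ W₂ T T≤ nte = mk⇔ to from
  where
  a = length W₁
  b = length W₂
  T′ = relabel (skip a) T
  g = colorsWith T
  T′≤ : AllEntries (_≤ a + suc b) T′
  T′≤ = AllEntries-relabel (λ {e} e≤ → ℕP.≤-trans (skip-≤-suc a e)
                                          (subst (suc e ≤_) (sym (ℕP.+-suc a b)) (s≤s e≤))) T T≤
  to : typeOf T′ ≡ W₁ ++ [] ∷ W₂ → typeOf T ≡ W₁ ++ W₂
  to eq = typeOf-from-segment (a + b) T (W₁ ++ W₂) T≤ (NoTrailingEmpty-drop W₁ W₂ nte)
    (trans (segment-++ g 0 a b) (cong₂ _++_ (proj₁ parts) (∷-injectiveʳ (proj₂ parts))))
    where
    parts = ++-injective-length (segment g 0 a) W₁ (length-segment g 0 a)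
      (trans (sym (segment-colorsWith-relabel-skip a b T))
             (trans (cong (segment (colorsWith T′) 0) (sym (length-++ W₁))) (segment-from-typeOf T′ _ eq)))
  from : typeOf T ≡ W₁ ++ W₂ → typeOf T′ ≡ W₁ ++ [] ∷ W₂
  from eq = typeOf-from-segment (a + suc b) T′ (W₁ ++ [] ∷ W₂) T′≤ nte
    (trans (segment-colorsWith-relabel-skip a b T)
           (cong₂ _++_ (proj₁ parts) (cong ([] ∷_) (proj₂ parts))))
    where parts = segment-from-typeOf-++ T W₁ W₂ eq

avoidsᵇ : ∀ {k} → ℕ → Box k → Bool
avoidsᵇ v b = isNo (proj₂ b ℕ.≟ v)

avoids : ∀ {k} → ℕ → Tableau k → Bool
avoids v = all (all (avoidsᵇ v))

typeOf-avoids : ∀ {k} (W₁ W₂ : WeakSentence k) (T : Tableau k) →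
  typeOf T ≡ W₁ ++ [] ∷ W₂ → Bool.T (avoids (suc (length W₁)) T)
typeOf-avoids W₁ W₂ T eq =
  AllP.all⁻ _ (All.map (AllP.all⁻ _ ∘ All.map fromWitnessFalse)
    (All-resp-↭ (↭-reverse T) (AllP.concat⁻ (colorsAt-≡[]⁻ (suc a) (readingWord T) noBox))))
  where
  a = length W₁
  noBox : colorsAt (suc a) (readingWord T) ≡ []
  noBox = trans (sym (colorsWith-readingWord T (suc a)))
                (∷-injectiveˡ (proj₂ (segment-from-typeOf-++ T W₁ ([] ∷ W₂) eq)))

filterᵇ-avoids-range1 : ∀ a b →
  filterᵇ (λ e → isNo (e ℕ.≟ suc a)) (range1 (suc (a + b))) ≡ map (skip a) (range1 (a + b))
filterᵇ-avoids-range1 a b = begin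
    filterᵇ q (range1 (suc (a + b)))
  ≡⟨ cong (filterᵇ q) (trans (range1-interval _)
                             (trans (cong (interval 0) (sym (ℕP.+-suc a b))) (segment-++ id 0 a (suc b)))) ⟩
    filterᵇ q (interval 0 a ++ suc a ∷ interval (suc a) b)
  ≡⟨ filter-++ (T? ∘ q) (interval 0 a) _ ⟩
    filterᵇ q (interval 0 a) ++ filterᵇ q (suc a ∷ interval (suc a) b)
  ≡⟨ cong₂ _++_ (filter-all (T? ∘ q) below)
                (trans (filter-reject (T? ∘ q) {suc a} {interval (suc a) b} (λ h → toWitnessFalse h refl))
                       (filter-all (T? ∘ q) above)) ⟩
    interval 0 a ++ interval (suc a) b
  ≡⟨ cong₂ _++_ lower upper ⟨
    map (skip a) (interval 0 a) ++ map (skip a) (interval a b)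
  ≡⟨ map-++ (skip a) (interval 0 a) (interval a b) ⟨
    map (skip a) (interval 0 a ++ interval a b)
  ≡⟨ cong (map (skip a)) (trans (sym (segment-++ id 0 a b)) (sym (range1-interval _))) ⟩
    map (skip a) (range1 (a + b)) ∎
  where
  open ≡-Reasoning
  q = λ e → isNo (e ℕ.≟ suc a)
  below : All (Bool.T ∘ q) (interval 0 a)
  below = All.map (λ (_ , i≤a) → fromWitnessFalse (ℕP.<⇒≢ (s≤s i≤a))) (interval-bounds 0 a)
  above : All (Bool.T ∘ q) (interval (suc a) b)
  above = All.map (λ (1+a<i , _) → fromWitnessFalse (ℕP.>⇒≢ 1+a<i)) (interval-bounds (suc a) b)
  lower : map (skip a) (interval 0 a) ≡ interval 0 a
  lower = trans (map-cong-local (All.map (λ (_ , i≤a) → skip-≤ i≤a) (interval-bounds 0 a))) (map-id _)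
  upper : map (skip a) (interval a b) ≡ interval (suc a) b
  upper = trans (map-cong-local (All.map (λ (a<i , _) → skip-> a<i) (interval-bounds a b)))
                (trans (sym (segment-interval suc a b)) (sym (segment-suc id a b)))

filterᵇ-avoids-fillWord : ∀ {k} a b (w : Word k) →
  filterᵇ (all (avoidsᵇ (suc a))) (fillWord w (suc (a + b)))
    ≡ map (map (map₂ (skip a))) (fillWord w (a + b))
filterᵇ-avoids-fillWord a b [] = refl
filterᵇ-avoids-fillWord a b (c ∷ w) =
  trans (filterᵇ-all-prependEach (avoidsᵇ (suc a)) (c ,_) (range1 (suc (a + b))) (fillWord w (suc (a + b))))
        (trans (cong₂ (prependEach (c ,_)) (filterᵇ-avoids-range1 a b) (filterᵇ-avoids-fillWord a b w))
               (sym (map-map-prependEach (map₂ (skip a)) (c ,_) (skip a) (λ _ → refl)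
                                         (range1 (a + b)) (fillWord w (a + b)))))

filterᵇ-avoids-fillings : ∀ {k} a b (J : WeakSentence k) →
  filterᵇ (avoids (suc a)) (fillings J (suc (a + b))) ≡ map (relabel (skip a)) (fillings J (a + b))
filterᵇ-avoids-fillings a b [] = refl
filterᵇ-avoids-fillings a b (w ∷ J) =
  trans (filterᵇ-all-prependEach (all (avoidsᵇ (suc a))) id
                                 (fillWord w (suc (a + b))) (fillings J (suc (a + b))))
        (trans (cong₂ (prependEach id) (filterᵇ-avoids-fillWord a b w) (filterᵇ-avoids-fillings a b J))
               (sym (map-map-prependEach (map (map₂ (skip a))) id (map (map₂ (skip a))) (λ _ → refl)
                                         (fillWord w (a + b)) (fillings J (a + b)))))

countCIT-delete-empty : ∀ {k} (J W₁ W₂ : WeakSentence k) → NoTrailingEmpty (W₁ ++ [] ∷ W₂) →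
  countCIT J (W₁ ++ [] ∷ W₂) ≡ countCIT J (W₁ ++ W₂)
countCIT-delete-empty {k} J W₁ W₂ nte = begin
    length (filter P? (fillings J (length W)))
  ≡⟨ cong (λ N → length (filter P? (fillings J N))) (trans (length-++ W₁) (ℕP.+-suc a b)) ⟩
    length (filter P? (fillings J (suc (a + b))))
  ≡⟨ cong length (filter-filter-⊆ P? (T? ∘ avoids (suc a)) (λ {T} (_ , eq) → typeOf-avoids W₁ W₂ T eq)
                                 (fillings J (suc (a + b)))) ⟨
    length (filter P? (filterᵇ (avoids (suc a)) (fillings J (suc (a + b)))))
  ≡⟨ cong (length ∘ filter P?) (filterᵇ-avoids-fillings a b J) ⟩
    length (filter P? (map (relabel (skip a)) (fillings J (a + b))))
  ≡⟨ cong length (filter-map P? (relabel (skip a)) (fillings J (a + b))) ⟩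
    length (map (relabel (skip a)) (filter (P? ∘ relabel (skip a)) (fillings J (a + b))))
  ≡⟨ length-map (relabel (skip a)) (filter (P? ∘ relabel (skip a)) (fillings J (a + b))) ⟩
    length (filter (P? ∘ relabel (skip a)) (fillings J (a + b)))
  ≡⟨ cong length (filter-≐-local (P? ∘ relabel (skip a)) Q? (All.map
       (λ {T} (_ , T∈) → IsCIT-relabel (skip-mono a) refl T
                         ×-⇔ typeOf-relabel-skip W₁ W₂ T (All.map (All.map proj₂) T∈) nte)
       (fillings-sound J (a + b)))) ⟩
    length (filter Q? (fillings J (a + b)))
  ≡⟨ cong (λ N → length (filter Q? (fillings J N))) (length-++ W₁) ⟨
    length (filter Q? (fillings J (length W′))) ∎
  where
  open ≡-Reasoning
  a = length W₁
  b = length W₂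
  W = W₁ ++ [] ∷ W₂
  W′ = W₁ ++ W₂
  P? = λ (T : Tableau k) → isCIT? T ×-dec (typeOf T ≟W W)
  Q? = λ (T : Tableau k) → isCIT? T ×-dec (typeOf T ≟W W′)

countCIT-++-dropEmpty : ∀ {k} (J W₁ W₂ : WeakSentence k) → NoTrailingEmpty (W₁ ++ W₂) →
  countCIT J (W₁ ++ W₂) ≡ countCIT J (W₁ ++ dropEmpty W₂)
countCIT-++-dropEmpty J W₁ [] nte = refl
countCIT-++-dropEmpty J W₁ ([] ∷ W₂) nte =
  trans (countCIT-delete-empty J W₁ W₂ nte)
        (countCIT-++-dropEmpty J W₁ W₂ (NoTrailingEmpty-drop W₁ W₂ nte))
countCIT-++-dropEmpty J W₁ (w@(_ ∷ _) ∷ W₂) nte = begin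
    countCIT J (W₁ ++ w ∷ W₂)
  ≡⟨ cong (countCIT J) (++-assoc W₁ [ w ] W₂) ⟨
    countCIT J ((W₁ ∷ʳ w) ++ W₂)
  ≡⟨ countCIT-++-dropEmpty J (W₁ ∷ʳ w) W₂ (subst NoTrailingEmpty (sym (++-assoc W₁ [ w ] W₂)) nte) ⟩
    countCIT J ((W₁ ∷ʳ w) ++ dropEmpty W₂)
  ≡⟨ cong (countCIT J) (++-assoc W₁ [ w ] (dropEmpty W₂)) ⟩
    countCIT J (W₁ ++ w ∷ dropEmpty W₂) ∎
  where open ≡-Reasoning

countCIT-dropEmpty : ∀ {k} (J W : WeakSentence k) → NoTrailingEmpty W →
  countCIT J W ≡ countCIT J (dropEmpty W)
countCIT-dropEmpty J W = countCIT-++-dropEmpty J [] W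

countCIT-via-dropEmpty : ∀ {k} (J W : WeakSentence k) → NoTrailingEmpty W →
  countCIT J W ≡ countCIT J (dropEmpty W) * 𝟙 (size W ≡ᵇ size J)
countCIT-via-dropEmpty J W nte with size W ≡ᵇ size J in eq
... | true = trans (countCIT-dropEmpty J W nte) (sym (ℕP.*-identityʳ (countCIT J (dropEmpty W))))
... | false = trans (countCIT-size J W (λ W≡J → subst Bool.T eq (ℕP.≡⇒≡ᵇ _ _ W≡J)))
                      (sym (ℕP.*-zeroʳ (countCIT J (dropEmpty W))))

theorem4p20 : (k : ℕ) (J : WeakSentence k) → IsSentence J →
    (W : WeakSentence k) → NoTrailingEmpty W →
    dualImm J W ≡ lincomb (sentencesOfSize k (size J)) (K J) M W
theorem4p20 k J _ W nte =
  trans (countCIT-via-dropEmpty J W nte) (sym (lincomb-sentencesOfSize-M (size J) (K J) W))
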